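{- Let $G$ be an $(n-3)$-regular graph on $n$ vertices. Then $G$ has an internal partition if and only if its complement $\bar G$ (which is $2$-regular, hence a disjoint union of cycles) has at most one odd cycle. Moreover, in that case $G$ has an internal partition $(A,B)$ that is a near-bisection, i.e. $||A|-|B||\le 1$.
   Context: Graphs are finite and simple; $\bar G$ is the complement of $G$. For $S\subseteq V$, $d_S(v)$ is the number of neighbors of $v$ in $S$ and $d(v)$ the degree of $v$. An internal partition is a partition $V=A\dot\cup B$ with $A,B\ne\emptyset$ such that $d_A(x)\ge d(x)/2$ for all $x\in A$ and $d_B(x)\ge d(x)/2$ for all $x\in B$. -}

module Defs where

open import Data.Nat using (ℕ; zero; suc; _+_; _*_; _∸_; _≤_; NonZero)
open import Data.Nat.DivMod using (_%_; m%n<n)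
open import Data.Fin using (Fin; toℕ; fromℕ<; _≟_)
open import Data.Bool using (Bool; true; false; not; _∧_; if_then_else_)
open import Data.Bool.Properties using (∧-comm)
open import Data.Product using (Σ; ∃; _×_; _,_)
open import Data.Sum using (_⊎_)
open import Relation.Nullary using (yes; no; ¬_)
open import Relation.Nullary.Decidable using (⌊_⌋)
open import Relation.Binary.PropositionalEquality using (_≡_; refl; sym; cong₂)
open import Function.Definitions using (Injective)

record Graph (n : ℕ) : Set where
  field
    adj    : Fin n → Fin n → Bool
    adjSym : ∀ i j → adj i j ≡ adj j i
    adjIrr : ∀ i → adj i i ≡ false
open Graph public

count : ∀ {n} → (Fin n → Bool) → ℕ
count {zero}  p = 0
count {suc n} p = (if p Fin.zero then 1 else 0) + count (λ i → p (Fin.suc i))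

deg : ∀ {n} → Graph n → Fin n → ℕ
deg G v = count (adj G v)

degIn : ∀ {n} → Graph n → (Fin n → Bool) → Fin n → ℕ
degIn G S v = count (λ u → S u ∧ adj G v u)

Regular : ∀ {n} → Graph n → ℕ → Set
Regular G k = ∀ v → deg G v ≡ k

private
  eqb-sym : ∀ {n} (i j : Fin n) → ⌊ i ≟ j ⌋ ≡ ⌊ j ≟ i ⌋
  eqb-sym i j with i ≟ j | j ≟ i
  ... | yes _ | yes _ = refl
  ... | no _  | no _  = refl
  ... | yes p | no q  = Data.Empty.⊥-elim (q (sym p)) where import Data.Empty
  ... | no p  | yes q = Data.Empty.⊥-elim (p (sym q)) where import Data.Empty

  eqb-refl : ∀ {n} (i : Fin n) → ⌊ i ≟ i ⌋ ≡ true
  eqb-refl i with i ≟ i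
  ... | yes _ = refl
  ... | no p  = Data.Empty.⊥-elim (p refl) where import Data.Empty

  and-false : ∀ b → b ∧ false ≡ false
  and-false true  = refl
  and-false false = refl

complement : ∀ {n} → Graph n → Graph n
complement G = record
  { adj    = λ i j → not (adj G i j) ∧ not ⌊ i ≟ j ⌋
  ; adjSym = λ i j → cong₂ (λ a b → not a ∧ not b) (adjSym G i j) (eqb-sym i j)
  ; adjIrr = λ i → subst-helper (adj G i i) (eqb-refl i)
  }
  where
  subst-helper : ∀ {n} {i : Fin n} (a : Bool) → ⌊ i ≟ i ⌋ ≡ true → not a ∧ not ⌊ i ≟ i ⌋ ≡ false
  subst-helper {i = i} a e with ⌊ i ≟ i ⌋
  subst-helper a refl | .true = and-false (not a)

IsInternalPartition : ∀ {n} → Graph n → (Fin n → Bool) → Set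
IsInternalPartition G A =
  (∃ λ a → A a ≡ true) × (∃ λ b → A b ≡ false) ×
  (∀ x → A x ≡ true  → deg G x ≤ 2 * degIn G A x) ×
  (∀ x → A x ≡ false → deg G x ≤ 2 * degIn G (λ u → not (A u)) x)

HasInternalPartition : ∀ {n} → Graph n → Set
HasInternalPartition G = ∃ λ A → IsInternalPartition G A

NearBisection : ∀ {n} → (Fin n → Bool) → Set
NearBisection A = count A ≤ suc (count (λ u → not (A u)))
                × count (λ u → not (A u)) ≤ suc (count A)

next : ∀ {k} .{{_ : NonZero k}} → Fin k → Fin k
next {k} i = fromℕ< (m%n<n (suc (toℕ i)) k)

record Cycle {n} (G : Graph n) : Set where
  field
    m        : ℕ
    vert     : Fin (3 + m) → Fin n
    vertInj  : Injective _≡_ _≡_ vert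
    vertAdj  : ∀ i → adj G (vert i) (vert (next i)) ≡ true
open Cycle public

cycleLength : ∀ {n} {G : Graph n} → Cycle G → ℕ
cycleLength C = 3 + m C

OddCycle : ∀ {n} {G : Graph n} → Cycle G → Set
OddCycle C = cycleLength C % 2 ≡ 1

CycleEdge : ∀ {n} {G : Graph n} → Cycle G → Fin n → Fin n → Set
CycleEdge C u v = ∃ λ i → (vert C i ≡ u × vert C (next i) ≡ v)
                        ⊎ (vert C i ≡ v × vert C (next i) ≡ u)

-- two cycles are the same subgraph: same edge set
SameCycle : ∀ {n} {G : Graph n} → Cycle G → Cycle G → Set
SameCycle C D = ∀ u v → (CycleEdge C u v → CycleEdge D u v) × (CycleEdge D u v → CycleEdge C u v)

AtMostOneOddCycle : ∀ {n} → Graph n → Set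
AtMostOneOddCycle G = (C D : Cycle G) → OddCycle C → OddCycle D → SameCycle C D

-- G is (n-3)-regular, so its complement H is 2-regular, i.e. a disjoint union of cycles, and
-- for x ∈ S the condition d_S(x) ≥ d(x)/2 reads 2 d̄_S(x) + |V ∖ S| ≤ |S| + 1 in H.  For a partition
-- (A, B) with |B| ≤ |A| this gives |A| ≤ |B| + 1 and no edge of H inside B, and double counting
-- (Σ_A d̄_A + 2|B| = Σ_B d̄_B + 2|A|) leaves at most one edge of H inside A.  Every odd cycle has an
-- edge inside one side, so all odd cycles share that edge and coincide.  Conversely, colouring each
-- cycle alternately from its least vertex makes every edge bichromatic except the closing edge of each
-- odd cycle; with at most one odd cycle this colouring satisfies the condition, with |A| - |B| ∈ {0, 1}.

module Submission where

open import Defs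
open import Data.Nat using (ℕ; zero; suc; _+_; _*_; _∸_; _≤_; _<_; _%_; z≤n; s≤s; z<s; s<s; s≤s⁻¹)
open import Data.Nat.Properties hiding (_≟_)
import Data.Nat.Properties as ℕ
open import Data.Nat.DivMod using (m<n⇒m%n≡m; n%n≡0)
open import Data.Nat.Induction using (<-rec)
open import Data.Nat.Tactic.RingSolver using (solve-∀)
open import Data.Fin using (Fin; zero; suc; toℕ; fromℕ; inject₁; punchOut; _≟_)
open import Data.Fin.Properties
  using (any?; pigeonhole; punchIn-punchOut; punchOut-injective; toℕ-fromℕ<; toℕ-fromℕ; toℕ-inject₁; toℕ-injective; toℕ<n)
import Data.Fin.Properties as Fin
open import Data.Fin.Induction using (<-weakInduction)
open import Data.Fin.Relation.Unary.Top using (view; ‵fromℕ; ‵inject₁)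
open import Data.Vec.Functional using (removeAt)
open import Data.Bool using (Bool; true; false; not; _∧_; if_then_else_)
import Data.Bool.Properties as Bool
open import Data.Product using (Σ; ∃; ∃₂; _×_; _,_; proj₁; proj₂; uncurry)
open import Data.Sum using (_⊎_; inj₁; inj₂)
import Data.Sum as Sum
open import Function using (_∘_; id; _⇔_; mk⇔; Equivalence; case_of_)
open Equivalence using (to; from)
open import Relation.Unary using (Decidable)
open import Relation.Nullary using (¬_; Dec; yes; no; contradiction)
open import Relation.Nullary.Decidable using (⌊_⌋; _×-dec_)
open import Relation.Binary.PropositionalEquality
open import Relation.Binary.Definitions using (tri<; tri≈; tri>)
open import Algebra.Properties.Semiring.Sum +-*-semiring
  using (sum; sum-cong-≗; sum-remove; ∑-distrib-+; ∑-comm; *-distribʳ-sum)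

private
  variable
    n k : ℕ

∧≡true⇒ˡ : ∀ a {b} → a ∧ b ≡ true → a ≡ true
∧≡true⇒ˡ true _ = refl

∧≡true⇒ʳ : ∀ a {b} → a ∧ b ≡ true → b ≡ true
∧≡true⇒ʳ true b≡true = b≡true

⟦_⟧ : Bool → ℕ
⟦ b ⟧ = if b then 1 else 0

count≡sum : (p : Fin n → Bool) → count p ≡ sum (λ i → ⟦ p i ⟧)
count≡sum {zero}  p = refl
count≡sum {suc n} p = cong (⟦ p zero ⟧ +_) (count≡sum (p ∘ suc))

sum-mono : {f g : Fin n → ℕ} → (∀ i → f i ≤ g i) → sum f ≤ sum g
sum-mono {zero}  f≤g = z≤n
sum-mono {suc n} f≤g = +-mono-≤ (f≤g zero) (sum-mono (f≤g ∘ suc))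

sum-zero : {f : Fin n → ℕ} → (∀ i → f i ≡ 0) → sum f ≡ 0
sum-zero {zero}  f≡0 = refl
sum-zero {suc n} f≡0 = cong₂ _+_ (f≡0 zero) (sum-zero (f≡0 ∘ suc))

sum-point : (f : Fin n → ℕ) (i : Fin n) → f i ≤ sum f
sum-point f zero    = m≤m+n (f zero) _
sum-point f (suc i) = ≤-trans (sum-point (f ∘ suc) i) (m≤n+m _ (f zero))

sum-pair : (f : Fin n → ℕ) {i j : Fin n} → i ≢ j → f i + f j ≤ sum f
sum-pair {suc n} f {i} {j} i≢j = begin
  f i + f j                                ≡⟨ cong (λ k → f i + f k) (punchIn-punchOut i≢j) ⟨
  f i + removeAt f i (punchOut i≢j)        ≤⟨ +-monoʳ-≤ (f i) (sum-point (removeAt f i) _) ⟩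
  f i + sum (removeAt f i)                 ≡⟨ sum-remove f ⟨
  sum f                                    ∎
  where open ≤-Reasoning

sum-triple : (f : Fin n → ℕ) {i j k : Fin n} → i ≢ j → i ≢ k → j ≢ k →
             f i + f j + f k ≤ sum f
sum-triple {suc n} f {i} {j} {k} i≢j i≢k j≢k = begin
  f i + f j + f k                                              ≡⟨ +-assoc (f i) _ _ ⟩
  f i + (f j + f k)
    ≡⟨ cong₂ (λ a b → f i + (f a + f b)) (punchIn-punchOut i≢j) (punchIn-punchOut i≢k) ⟨
  f i + (removeAt f i (punchOut i≢j) + removeAt f i (punchOut i≢k))
    ≤⟨ +-monoʳ-≤ (f i) (sum-pair (removeAt f i) (j≢k ∘ punchOut-injective i≢j i≢k)) ⟩
  f i + sum (removeAt f i)                                     ≡⟨ sum-remove f ⟨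
  sum f                                                        ∎
  where open ≤-Reasoning

count-cong : {p q : Fin n → Bool} → (∀ i → p i ≡ q i) → count p ≡ count q
count-cong {zero}  p≗q = refl
count-cong {suc n} p≗q = cong₂ _+_ (cong ⟦_⟧ (p≗q zero)) (count-cong (p≗q ∘ suc))

count-+ : {p q r : Fin n → Bool} → (∀ i → ⟦ p i ⟧ + ⟦ q i ⟧ ≡ ⟦ r i ⟧) →
          count p + count q ≡ count r
count-+ {p = p} {q} {r} pointwise = begin
  count p + count q                            ≡⟨ cong₂ _+_ (count≡sum p) (count≡sum q) ⟩
  sum (λ i → ⟦ p i ⟧) + sum (λ i → ⟦ q i ⟧)    ≡⟨ ∑-distrib-+ (λ i → ⟦ p i ⟧) (λ i → ⟦ q i ⟧) ⟨
  sum (λ i → ⟦ p i ⟧ + ⟦ q i ⟧)                ≡⟨ sum-cong-≗ pointwise ⟩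
  sum (λ i → ⟦ r i ⟧)                          ≡⟨ count≡sum r ⟨
  count r                                      ∎
  where open ≡-Reasoning

count-true : count {n} (λ _ → true) ≡ n
count-true {zero}  = refl
count-true {suc n} = cong suc count-true

count-false : {p : Fin n → Bool} → (∀ i → p i ≡ false) → count p ≡ 0
count-false {zero}  p≡false = refl
count-false {suc n} p≡false = cong₂ _+_ (cong ⟦_⟧ (p≡false zero)) (count-false (p≡false ∘ suc))

count-point : (p : Fin n → Bool) {i : Fin n} → p i ≡ true → 1 ≤ count p
count-point p {i} pi = subst (1 ≤_) (sym (count≡sum p))
  (subst (λ b → ⟦ b ⟧ ≤ sum (λ j → ⟦ p j ⟧)) pi (sum-point (λ j → ⟦ p j ⟧) i))

count≡0⇒false : (p : Fin n → Bool) → count p ≡ 0 → ∀ i → p i ≡ false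
count≡0⇒false p count≡0 i with p i in pi
... | false = refl
... | true  = contradiction (subst (1 ≤_) count≡0 (count-point p pi)) λ ()

count-pos⇒∃ : (p : Fin n → Bool) → 1 ≤ count p → ∃ λ i → p i ≡ true
count-pos⇒∃ {suc n} p pos with p zero in p0
... | true  = zero , p0
... | false = let i , pi = count-pos⇒∃ (p ∘ suc) pos in suc i , pi

count≤1 : (p : Fin n → Bool) → (∀ {i j} → p i ≡ true → p j ≡ true → i ≡ j) → count p ≤ 1
count≤1 {zero}  p unique = z≤n
count≤1 {suc n} p unique with p zero in p0
... | false = count≤1 (p ∘ suc) λ pi pj → Fin.suc-injective (unique pi pj)
... | true  = s≤s (≤-reflexive (count-false rest-false))
  where
  rest-false : ∀ i → p (suc i) ≡ false
  rest-false i with p (suc i) in pi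
  ... | false = refl
  ... | true  = contradiction (unique p0 pi) λ ()


count≡1⇒unique : (p : Fin n → Bool) → count p ≡ 1 →
                 ∃ λ a → p a ≡ true × ∀ {y} → p y ≡ true → y ≡ a
count≡1⇒unique {suc n} p count≡1 with p zero in p0
... | true  = zero , p0 , only-zero
  where
  only-zero : ∀ {y} → p y ≡ true → y ≡ zero
  only-zero {zero}  _  = refl
  only-zero {suc y} py = contradiction (trans (sym py) (count≡0⇒false (p ∘ suc) (suc-injective count≡1) y)) λ ()
... | false with a , pa , only-a ← count≡1⇒unique (p ∘ suc) count≡1 = suc a , pa , only-suc-a
  where
  only-suc-a : ∀ {y} → p y ≡ true → y ≡ suc a
  only-suc-a {zero}  py = contradiction (trans (sym py) p0) λ ()
  only-suc-a {suc y} py = cong suc (only-a py)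

count≡2⇒pair : (p : Fin n → Bool) → count p ≡ 2 →
               ∃₂ λ a b → a ≢ b × p a ≡ true × p b ≡ true × ∀ {y} → p y ≡ true → y ≡ a ⊎ y ≡ b
count≡2⇒pair {suc n} p count≡2 with p zero in p0
... | true with b , pb , only-b ← count≡1⇒unique (p ∘ suc) (suc-injective count≡2) =
  zero , suc b , (λ ()) , p0 , pb , zero-or-suc-b
  where
  zero-or-suc-b : ∀ {y} → p y ≡ true → y ≡ zero ⊎ y ≡ suc b
  zero-or-suc-b {zero}  _  = inj₁ refl
  zero-or-suc-b {suc y} py = inj₂ (cong suc (only-b py))
... | false with a , b , a≢b , pa , pb , only-ab ← count≡2⇒pair (p ∘ suc) count≡2 =
  suc a , suc b , a≢b ∘ Fin.suc-injective , pa , pb , suc-a-or-suc-b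
  where
  suc-a-or-suc-b : ∀ {y} → p y ≡ true → y ≡ suc a ⊎ y ≡ suc b
  suc-a-or-suc-b {zero}  py = contradiction (trans (sym py) p0) λ ()
  suc-a-or-suc-b {suc y} py = Sum.map (cong suc) (cong suc) (only-ab py)

⌊≟⌋⇒≡ : {x u : Fin n} → ⌊ x ≟ u ⌋ ≡ true → x ≡ u
⌊≟⌋⇒≡ {x = x} {u} e with x ≟ u | e
... | yes x≡u | _ = x≡u

⌊≟⌋-refl : {x : Fin n} → ⌊ x ≟ x ⌋ ≡ true
⌊≟⌋-refl {x = x} with x ≟ x
... | yes _   = refl
... | no x≢x = contradiction refl x≢x

count-singleton : (x : Fin n) → count (λ u → ⌊ x ≟ u ⌋) ≡ 1
count-singleton x = ≤-antisym
  (count≤1 (λ u → ⌊ x ≟ u ⌋) λ xi xj → trans (sym (⌊≟⌋⇒≡ xi)) (⌊≟⌋⇒≡ xj))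
  (count-point (λ u → ⌊ x ≟ u ⌋) ⌊≟⌋-refl)

-- Arcs and double counting

arcs-at : Graph n → (Fin n → Bool) → (Fin n → Bool) → Fin n → ℕ
arcs-at H S T x = ⟦ S x ⟧ * degIn H T x

-- Σ_{x ∈ S} d_T(x), the number of ordered pairs of adjacent vertices in S × T
arcs : Graph n → (Fin n → Bool) → (Fin n → Bool) → ℕ
arcs H S T = sum (arcs-at H S T)

degIn-cong : (H : Graph n) {S T : Fin n → Bool} → (∀ u → S u ≡ T u) → ∀ x → degIn H S x ≡ degIn H T x
degIn-cong H S≗T x = count-cong λ u → cong (_∧ adj H x u) (S≗T u)

arcs-cong : (H : Graph n) (S : Fin n → Bool) {T T′ : Fin n → Bool} → (∀ u → T u ≡ T′ u) →
            arcs H S T ≡ arcs H S T′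
arcs-cong H S T≗T′ = sum-cong-≗ λ x → cong (⟦ S x ⟧ *_) (degIn-cong H T≗T′ x)

arcs≡double-sum : (H : Graph n) (S T : Fin n → Bool) →
                  arcs H S T ≡ sum (λ x → sum (λ u → ⟦ S x ∧ (T u ∧ adj H x u) ⟧))
arcs≡double-sum {n = n} H S T = sum-cong-≗ λ x → ⟦S⟧*degIn (S x) x
  where
  ⟦S⟧*degIn : ∀ b x → ⟦ b ⟧ * degIn H T x ≡ sum (λ u → ⟦ b ∧ (T u ∧ adj H x u) ⟧)
  ⟦S⟧*degIn true  x = trans (*-identityˡ _) (count≡sum (λ u → T u ∧ adj H x u))
  ⟦S⟧*degIn false x = sym (sum-zero {n = n} λ _ → refl)

arcs-sym : (H : Graph n) (S T : Fin n → Bool) → arcs H S T ≡ arcs H T S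
arcs-sym H S T = begin
  arcs H S T                                                  ≡⟨ arcs≡double-sum H S T ⟩
  sum (λ x → sum (λ u → ⟦ S x ∧ (T u ∧ adj H x u) ⟧))
    ≡⟨ ∑-comm (λ x u → ⟦ S x ∧ (T u ∧ adj H x u) ⟧) ⟩
  sum (λ u → sum (λ x → ⟦ S x ∧ (T u ∧ adj H x u) ⟧))
    ≡⟨ sum-cong-≗ (λ u → sum-cong-≗ λ x → swap (S x) (T u) (adjSym H x u)) ⟩
  sum (λ u → sum (λ x → ⟦ T u ∧ (S x ∧ adj H u x) ⟧))         ≡⟨ arcs≡double-sum H T S ⟨
  arcs H T S                                                  ∎
  where
  open ≡-Reasoning
  swap : ∀ a b {c d} → c ≡ d → ⟦ a ∧ (b ∧ c) ⟧ ≡ ⟦ b ∧ (a ∧ d) ⟧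
  swap true  b     refl = refl
  swap false true  refl = refl
  swap false false refl = refl

degIn+degIn-not : (H : Graph n) (T : Fin n → Bool) (x : Fin n) →
                  degIn H T x + degIn H (not ∘ T) x ≡ deg H x
degIn+degIn-not H T x = count-+ λ u → split (T u) (adj H x u)
  where
  split : ∀ t a → ⟦ t ∧ a ⟧ + ⟦ not t ∧ a ⟧ ≡ ⟦ a ⟧
  split true  a     = +-identityʳ _
  split false a     = refl

arcs+arcs-not : (H : Graph n) → Regular H k → (S T : Fin n → Bool) →
                arcs H S T + arcs H S (not ∘ T) ≡ count S * k
arcs+arcs-not {k = k} H regular S T = begin
  arcs H S T + arcs H S (not ∘ T)
    ≡⟨ ∑-distrib-+ (λ x → ⟦ S x ⟧ * degIn H T x) (λ x → ⟦ S x ⟧ * degIn H (not ∘ T) x) ⟨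
  sum (λ x → ⟦ S x ⟧ * degIn H T x + ⟦ S x ⟧ * degIn H (not ∘ T) x)
    ≡⟨ sum-cong-≗ (λ x → trans (sym (*-distribˡ-+ ⟦ S x ⟧ _ _))
                               (cong (⟦ S x ⟧ *_) (trans (degIn+degIn-not H T x) (regular x)))) ⟩
  sum (λ x → ⟦ S x ⟧ * k)                                 ≡⟨ *-distribʳ-sum k (λ x → ⟦ S x ⟧) ⟨
  sum (λ x → ⟦ S x ⟧) * k                                 ≡⟨ cong (_* k) (count≡sum S) ⟨
  count S * k                                             ∎
  where open ≡-Reasoning

-- Both sides equal arcs H A A + arcs H B B + arcs H A B.
arcs-within-balance : (H : Graph n) → Regular H k → (A : Fin n → Bool) →
  arcs H A A + count (not ∘ A) * k ≡ arcs H (not ∘ A) (not ∘ A) + count A * k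
arcs-within-balance {k = k} H regular A = begin
  arcs H A A + count B * k                   ≡⟨ cong (arcs H A A +_) (arcs+arcs-not H regular B B) ⟨
  arcs H A A + (arcs H B B + arcs H B (not ∘ B))
    ≡⟨ cong (λ m → arcs H A A + (arcs H B B + m)) (trans (arcs-cong H B (Bool.not-involutive ∘ A)) (arcs-sym H B A)) ⟩
  arcs H A A + (arcs H B B + arcs H A B)     ≡⟨ +-assoc (arcs H A A) _ _ ⟨
  arcs H A A + arcs H B B + arcs H A B       ≡⟨ cong (_+ arcs H A B) (+-comm (arcs H A A) _) ⟩
  arcs H B B + arcs H A A + arcs H A B       ≡⟨ +-assoc (arcs H B B) _ _ ⟩
  arcs H B B + (arcs H A A + arcs H A B)     ≡⟨ cong (arcs H B B +_) (arcs+arcs-not H regular A A) ⟩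
  arcs H B B + count A * k                   ∎
  where
  open ≡-Reasoning
  B : Fin _ → Bool
  B = not ∘ A

-- The internal condition read in the complement

-- Every other vertex is adjacent to x in exactly one of G and Ḡ.
degIn+degIn-complement : (G : Graph n) (S : Fin n → Bool) {x : Fin n} → S x ≡ true →
  degIn G S x + degIn (complement G) S x + 1 ≡ count S
degIn+degIn-complement G S {x} Sx = begin
  degIn G S x + degIn (complement G) S x + 1    ≡⟨ cong (_+ 1) (count-+ G-or-Ḡ) ⟩
  count others + 1                              ≡⟨ cong (count others +_) count-x ⟨
  count others + count (λ u → S u ∧ ⌊ x ≟ u ⌋)  ≡⟨ count-+ (λ u → other-or-x (S u) ⌊ x ≟ u ⌋) ⟩
  count S                                       ∎
  where
  open ≡-Reasoning
  others : Fin _ → Bool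
  others u = S u ∧ not ⌊ x ≟ u ⌋

  G-or-Ḡ : ∀ u → ⟦ S u ∧ adj G x u ⟧ + ⟦ S u ∧ adj (complement G) x u ⟧ ≡ ⟦ others u ⟧
  G-or-Ḡ u with x ≟ u
  ... | yes refl rewrite adjIrr G x | Bool.∧-zeroʳ (S x) = refl
  ... | no _ with S u | adj G x u
  ...   | true  | true  = refl
  ...   | true  | false = refl
  ...   | false | _     = refl

  other-or-x : ∀ s e → ⟦ s ∧ not e ⟧ + ⟦ s ∧ e ⟧ ≡ ⟦ s ⟧
  other-or-x true  true  = refl
  other-or-x true  false = refl
  other-or-x false _     = refl

  count-x : count (λ u → S u ∧ ⌊ x ≟ u ⌋) ≡ 1
  count-x = trans (count-cong only-x) (count-singleton x)
    where
    only-x : ∀ u → S u ∧ ⌊ x ≟ u ⌋ ≡ ⌊ x ≟ u ⌋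
    only-x u with x ≟ u
    ... | yes refl = trans (Bool.∧-identityʳ (S x)) Sx
    ... | no _     = Bool.∧-zeroʳ (S u)

count+count-not : (S : Fin n → Bool) → count S + count (not ∘ S) ≡ n
count+count-not S = trans (count-+ λ u → one-side (S u)) count-true
  where
  one-side : ∀ s → ⟦ s ⟧ + ⟦ not s ⟧ ≡ 1
  one-side true  = refl
  one-side false = refl

deg+3≡n : 3 ≤ n → (G : Graph n) → Regular G (n ∸ 3) → ∀ x → deg G x + 3 ≡ n
deg+3≡n 3≤n G regular x = trans (cong (_+ 3) (regular x)) (m∸n+n≡m 3≤n)

complement-regular : 3 ≤ n → (G : Graph n) → Regular G (n ∸ 3) → Regular (complement G) 2
complement-regular {n} 3≤n G regular x = +-cancelˡ-≡ (deg G x) _ _ (+-cancelʳ-≡ 1 _ _ (begin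
  deg G x + deg (complement G) x + 1   ≡⟨ degIn+degIn-complement G (λ _ → true) refl ⟩
  count {n} (λ _ → true)               ≡⟨ count-true ⟩
  n                                    ≡⟨ deg+3≡n 3≤n G regular x ⟨
  deg G x + 3                          ≡⟨ +-assoc (deg G x) 2 1 ⟨
  deg G x + 2 + 1                      ∎))
  where open ≡-Reasoning

-- Both sides are equivalent to h + t ≤ g + 2.
local-condition-arith : ∀ {d g h s t} → d + 3 ≡ s + t → g + h + 1 ≡ s →
                        d ≤ 2 * g ⇔ 2 * h + t ≤ suc s
local-condition-arith {d} {g} {h} {_} {t} d+3≡s+t refl = mk⇔
  (λ d≤2g → subst₂ _≤_ (sym (e₃ h t)) (sym (e₄ g h))
     (+-monoˡ-≤ h (+-cancelʳ-≤ (g + 1) _ _ (subst₂ _≤_ e₁ (e₂ g) (+-monoˡ-≤ 3 d≤2g)))))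
  (λ le → +-cancelʳ-≤ 3 _ _ (subst₂ _≤_ (sym e₁) (sym (e₂ g))
     (+-monoˡ-≤ (g + 1) (+-cancelʳ-≤ h _ _ (subst₂ _≤_ (e₃ h t) (e₄ g h) le)))))
  where
  e₀ : ∀ g h t → g + h + 1 + t ≡ h + t + (g + 1)
  e₀ = solve-∀
  e₁ : d + 3 ≡ h + t + (g + 1)
  e₁ = trans d+3≡s+t (e₀ g h t)
  e₂ : ∀ g → 2 * g + 3 ≡ g + 2 + (g + 1)
  e₂ = solve-∀
  e₃ : ∀ h t → 2 * h + t ≡ h + t + h
  e₃ = solve-∀
  e₄ : ∀ g h → suc (g + h + 1) ≡ g + 2 + h
  e₄ = solve-∀

internal-at⇔ : 3 ≤ n → (G : Graph n) → Regular G (n ∸ 3) → (S : Fin n → Bool) {x : Fin n} → S x ≡ true →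
  deg G x ≤ 2 * degIn G S x ⇔ 2 * degIn (complement G) S x + count (not ∘ S) ≤ suc (count S)
internal-at⇔ 3≤n G regular S {x} Sx = local-condition-arith {g = degIn G S x} {h = degIn (complement G) S x}
  (trans (deg+3≡n 3≤n G regular x) (sym (count+count-not S)))
  (degIn+degIn-complement G S Sx)

-- d_S(x) ≥ d(x)/2 at every x ∈ S, rewritten in the complement of an (n-3)-regular graph (internal-at⇔).
CoInternalSide : Graph n → (Fin n → Bool) → Set
CoInternalSide H S = ∀ x → S x ≡ true → 2 * degIn H S x + count (not ∘ S) ≤ suc (count S)

IsCoInternalPartition : Graph n → (Fin n → Bool) → Set
IsCoInternalPartition H A =
  (∃ λ a → A a ≡ true) × (∃ λ b → A b ≡ false) × CoInternalSide H A × CoInternalSide H (not ∘ A)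

internal⇔coInternal : 3 ≤ n → (G : Graph n) → Regular G (n ∸ 3) → (A : Fin n → Bool) →
                      IsInternalPartition G A ⇔ IsCoInternalPartition (complement G) A
internal⇔coInternal 3≤n G regular A = mk⇔
  (λ (a , b , inA , inB) → a , b , (λ x Ax → to (side A Ax) (inA x Ax))
                                 , (λ x Bx → to (side (not ∘ A) Bx) (inB x (Bool.not-injective Bx))))
  (λ (a , b , inA , inB) → a , b , (λ x Ax → from (side A Ax) (inA x Ax))
                                 , (λ x Ax → from (side (not ∘ A) (cong not Ax)) (inB x (cong not Ax))))
  where
  side : (S : Fin _ → Bool) {x : Fin _} → S x ≡ true →
         deg G x ≤ 2 * degIn G S x ⇔ 2 * degIn (complement G) S x + count (not ∘ S) ≤ suc (count S)
  side = internal-at⇔ 3≤n G regular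

CoInternalSide-cong : (H : Graph n) {S T : Fin n → Bool} → (∀ u → S u ≡ T u) →
                      CoInternalSide H S → CoInternalSide H T
CoInternalSide-cong H {S} {T} S≗T side x Tx = begin
  2 * degIn H T x + count (not ∘ T)  ≡⟨ cong₂ (λ d c → 2 * d + c) (degIn-cong H S≗T x) (count-cong (cong not ∘ S≗T)) ⟨
  2 * degIn H S x + count (not ∘ S)  ≤⟨ side x (trans (S≗T x) Tx) ⟩
  suc (count S)                      ≡⟨ cong suc (count-cong S≗T) ⟩
  suc (count T)                      ∎
  where open ≤-Reasoning

coInternal-swap : (H : Graph n) {A : Fin n → Bool} → IsCoInternalPartition H A → IsCoInternalPartition H (not ∘ A)
coInternal-swap H {A} ((a , Aa) , (b , Ab) , sideA , sideB) =
  (b , cong not Ab) , (a , cong not Aa) , sideB , CoInternalSide-cong H (sym ∘ Bool.not-involutive ∘ A) sideA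

coInternal⇒nearBisection : (H : Graph n) {A : Fin n → Bool} → IsCoInternalPartition H A → NearBisection A
coInternal⇒nearBisection H {A} ((a , Aa) , (b , Ab) , sideA , sideB) =
  (begin
    count A                                             ≤⟨ m≤n+m _ _ ⟩
    2 * degIn H (not ∘ A) b + count A
      ≡⟨ cong (2 * degIn H (not ∘ A) b +_) (count-cong (Bool.not-involutive ∘ A)) ⟨
    2 * degIn H (not ∘ A) b + count (not ∘ (not ∘ A))   ≤⟨ sideB b (cong not Ab) ⟩
    suc (count (not ∘ A))                               ∎) ,
  ≤-trans (m≤n+m _ _) (sideA a Aa)
  where open ≤-Reasoning

next-inject₁ : (j : Fin (2 + k)) → next (inject₁ j) ≡ suc j
next-inject₁ {k} j = toℕ-injective (begin
  toℕ (next (inject₁ j))        ≡⟨ toℕ-fromℕ< _ ⟩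
  suc (toℕ (inject₁ j)) % (3 + k) ≡⟨ cong (λ t → suc t % (3 + k)) (toℕ-inject₁ j) ⟩
  suc (toℕ j) % (3 + k)           ≡⟨ m<n⇒m%n≡m (s≤s (toℕ<n j)) ⟩
  suc (toℕ j)                     ∎)
  where open ≡-Reasoning

next-fromℕ : next (fromℕ (2 + k)) ≡ zero
next-fromℕ {k} = toℕ-injective (begin
  toℕ (next (fromℕ (2 + k)))           ≡⟨ toℕ-fromℕ< _ ⟩
  suc (toℕ (fromℕ (2 + k))) % (3 + k)  ≡⟨ cong (λ t → suc t % (3 + k)) (toℕ-fromℕ (2 + k)) ⟩
  (3 + k) % (3 + k)                    ≡⟨ n%n≡0 (3 + k) ⟩
  0                                    ∎)
  where open ≡-Reasoning

prev : Fin (3 + k) → Fin (3 + k)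
prev zero    = fromℕ _
prev (suc j) = inject₁ j

next-prev : (i : Fin (3 + k)) → next (prev i) ≡ i
next-prev zero    = next-fromℕ
next-prev (suc j) = next-inject₁ j

next∘next≢id : (i : Fin (3 + k)) → next (next i) ≢ i
next∘next≢id i with view i
... | ‵fromℕ     = λ e → case trans (trans (sym (next-inject₁ zero)) (cong next (sym next-fromℕ))) e of λ ()
... | ‵inject₁ j with view j
...   | ‵fromℕ      = λ e → case trans (sym (trans (cong next (next-inject₁ j)) next-fromℕ)) e of λ ()
...   | ‵inject₁ j′ = λ e → <⇒≢ (m<n+m (toℕ j′) {2} z<s) (sym (begin
  2 + toℕ j′
    ≡⟨ cong toℕ (trans (cong next (next-inject₁ (inject₁ j′))) (next-inject₁ (suc j′))) ⟨
  toℕ (next (next (inject₁ (inject₁ j′)))) ≡⟨ cong toℕ e ⟩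
  toℕ (inject₁ (inject₁ j′))               ≡⟨ trans (toℕ-inject₁ _) (toℕ-inject₁ j′) ⟩
  toℕ j′                                   ∎))
  where open ≡-Reasoning

next-invariant : (P : Fin (3 + k) → Set) → (∀ i → P i → P (next i)) → (∀ i → P (next i) → P i) →
                 ∀ {i₀} → P i₀ → ∀ i → P i
next-invariant P forward backward {i₀} Pi₀ i = to (P₀⇔ i) (from (P₀⇔ i₀) Pi₀)
  where
  P₀⇔ : ∀ i → P zero ⇔ P i
  P₀⇔ = <-weakInduction (λ i → P zero ⇔ P i) (mk⇔ id id) λ j P₀⇔Pj → mk⇔
    (λ P₀ → subst P (next-inject₁ j) (forward _ (to P₀⇔Pj P₀)))
    (λ Psj → from P₀⇔Pj (backward _ (subst P (sym (next-inject₁ j)) Psj)))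

flips : ℕ → Bool → Bool
flips zero    b = b
flips (suc t) b = not (flips t b)

flips-odd : ∀ t b → t % 2 ≡ 1 → flips t b ≡ not b
flips-odd 1             b _   = refl
flips-odd (suc (suc t)) b odd = trans (Bool.not-involutive _) (flips-odd t b odd)

flips-fixed⇒odd : ∀ t b → flips t b ≡ b → suc t % 2 ≡ 1
flips-fixed⇒odd zero          b _     = refl
flips-fixed⇒odd (suc zero)    b fixed = contradiction (sym fixed) (Bool.not-¬ refl)
flips-fixed⇒odd (suc (suc t)) b fixed = flips-fixed⇒odd t b (trans (sym (Bool.not-involutive _)) fixed)

alternating⇒flips : (c : Fin (3 + k) → Bool) → (∀ i → c (next i) ≡ not (c i)) →
                    ∀ i → c i ≡ flips (toℕ i) (c zero)
alternating⇒flips c alternating = <-weakInduction (λ i → c i ≡ flips (toℕ i) (c zero)) refl λ j cj →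
  begin
    c (suc j)                              ≡⟨ cong c (next-inject₁ j) ⟨
    c (next (inject₁ j))                   ≡⟨ alternating (inject₁ j) ⟩
    not (c (inject₁ j))                    ≡⟨ cong not cj ⟩
    not (flips (toℕ (inject₁ j)) (c zero)) ≡⟨ cong (λ t → not (flips t (c zero))) (toℕ-inject₁ j) ⟩
    flips (toℕ (suc j)) (c zero)           ∎
  where open ≡-Reasoning

odd-colouring-repeats : (3 + k) % 2 ≡ 1 → (c : Fin (3 + k) → Bool) → ∃ λ i → c i ≡ c (next i)
odd-colouring-repeats {k} odd c with any? (λ i → c i Bool.≟ c (next i))
... | yes repeat = repeat
... | no ¬repeat = contradiction (begin
    c zero                          ≡⟨ cong c next-fromℕ ⟨
    c (next (fromℕ (2 + k)))        ≡⟨ alternating (fromℕ (2 + k)) ⟩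
    not (c (fromℕ (2 + k)))         ≡⟨ cong not (alternating⇒flips c alternating (fromℕ (2 + k))) ⟩
    not (flips (toℕ (fromℕ (2 + k))) (c zero)) ≡⟨ cong (λ t → not (flips t (c zero))) (toℕ-fromℕ (2 + k)) ⟩
    flips (3 + k) (c zero)          ≡⟨ flips-odd (3 + k) (c zero) odd ⟩
    not (c zero)                    ∎) (Bool.not-¬ refl)
  where
  open ≡-Reasoning
  alternating : ∀ i → c (next i) ≡ not (c i)
  alternating i = Bool.¬-not λ e → ¬repeat (i , sym e)

flips-closing : (i : Fin (3 + k)) → flips (toℕ i) true ≡ flips (toℕ (next i)) true →
                i ≡ fromℕ (2 + k) × flips (toℕ i) true ≡ true × (3 + k) % 2 ≡ 1
flips-closing {k} i same with view i
... | ‵fromℕ = refl , true-at-last ,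
  flips-fixed⇒odd (2 + k) true (subst (λ t → flips t true ≡ true) (toℕ-fromℕ (2 + k)) true-at-last)
  where
  true-at-last : flips (toℕ (fromℕ (2 + k))) true ≡ true
  true-at-last = trans same (cong (λ j → flips (toℕ j) true) (next-fromℕ {k}))
... | ‵inject₁ j = contradiction (begin
    flips (toℕ j) true                  ≡⟨ cong (λ t → flips t true) (toℕ-inject₁ j) ⟨
    flips (toℕ (inject₁ j)) true        ≡⟨ same ⟩
    flips (toℕ (next (inject₁ j))) true ≡⟨ cong (λ j → flips (toℕ j) true) (next-inject₁ j) ⟩
    not (flips (toℕ j) true)            ∎) (Bool.not-¬ refl)
  where open ≡-Reasoning

-- Cycles in a 2-regular graph

infix 4 _∈ᶜ_
_∈ᶜ_ : {H : Graph n} → Fin n → Cycle H → Set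
x ∈ᶜ C = ∃ λ i → vert C i ≡ x

_∈ᶜ?_ : {H : Graph n} (y : Fin n) (C : Cycle H) → Dec (y ∈ᶜ C)
y ∈ᶜ? C = any? λ i → vert C i ≟ y

ClosingEdge : {H : Graph n} → Cycle H → Fin n → Fin n → Set
ClosingEdge C u v = (u ≡ vert C (fromℕ _) × v ≡ vert C zero) ⊎ (u ≡ vert C zero × v ≡ vert C (fromℕ _))

closing-edges-meet : {H : Graph n} {C : Cycle H} {u v u′ v′ : Fin n} →
                     ClosingEdge C u v → ClosingEdge C u′ v′ → u′ ≡ u ⊎ u′ ≡ v
closing-edges-meet (inj₁ (refl , refl)) (inj₁ (refl , _)) = inj₁ refl
closing-edges-meet (inj₁ (refl , refl)) (inj₂ (refl , _)) = inj₂ refl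
closing-edges-meet (inj₂ (refl , refl)) (inj₁ (refl , _)) = inj₂ refl
closing-edges-meet (inj₂ (refl , refl)) (inj₂ (refl , _)) = inj₁ refl

adj⇒≢ : (H : Graph n) {x y : Fin n} → adj H x y ≡ true → x ≢ y
adj⇒≢ H {x} xy refl = contradiction (trans (sym (adjIrr H x)) xy) λ ()

SameCycle⇒⊆ : {H : Graph n} {C D : Cycle H} → SameCycle C D → ∀ {u} → u ∈ᶜ C → u ∈ᶜ D
SameCycle⇒⊆ C≈D (i , refl) with proj₁ (C≈D _ _) (i , inj₁ (refl , refl))
... | j , inj₁ (u≡ , _) = j , u≡
... | j , inj₂ (_ , u≡) = next j , u≡

module TwoRegular (H : Graph n) (regular : Regular H 2) where

  neighbour-pair : ∀ x → ∃₂ λ p q → p ≢ q × adj H x p ≡ true × adj H x q ≡ true ×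
                                   ∀ {y} → adj H x y ≡ true → y ≡ p ⊎ y ≡ q
  neighbour-pair x = count≡2⇒pair (adj H x) (regular x)

  only-neighbours : ∀ {x a b} → a ≢ b → adj H x a ≡ true → adj H x b ≡ true →
                    ∀ {y} → adj H x y ≡ true → y ≡ a ⊎ y ≡ b
  only-neighbours {x} a≢b xa xb xy with p , q , _ , _ , _ , p-or-q ← neighbour-pair x =
    among a≢b (p-or-q xa) (p-or-q xb) (p-or-q xy)
    where
    among : ∀ {a b y} → a ≢ b → a ≡ p ⊎ a ≡ q → b ≡ p ⊎ b ≡ q → y ≡ p ⊎ y ≡ q → y ≡ a ⊎ y ≡ b
    among a≢b (inj₁ refl) (inj₁ refl) _          = contradiction refl a≢b
    among a≢b (inj₂ refl) (inj₂ refl) _          = contradiction refl a≢b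
    among _   (inj₁ refl) (inj₂ refl) y∈        = y∈
    among _   (inj₂ refl) (inj₁ refl) (inj₁ y≡) = inj₂ y≡
    among _   (inj₂ refl) (inj₁ refl) (inj₂ y≡) = inj₁ y≡

  module _ (C : Cycle H) where

    adj-prev : ∀ i → adj H (vert C i) (vert C (prev i)) ≡ true
    adj-prev i = trans (adjSym H _ _)
      (subst (λ j → adj H (vert C (prev i)) (vert C j) ≡ true) (next-prev i) (vertAdj C (prev i)))

    cycle-neighbours : ∀ i {y} → adj H (vert C i) y ≡ true → y ≡ vert C (next i) ⊎ y ≡ vert C (prev i)
    cycle-neighbours i = only-neighbours next≢prev (vertAdj C i) (adj-prev i)
      where
      next≢prev : vert C (next i) ≢ vert C (prev i)
      next≢prev e = next∘next≢id (prev i) (trans (cong next (next-prev i)) (vertInj C e))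

    ∈ᶜ-closed : ∀ {x y} → x ∈ᶜ C → adj H x y ≡ true → y ∈ᶜ C
    ∈ᶜ-closed (i , refl) xy with cycle-neighbours i xy
    ... | inj₁ y≡ = next i , sym y≡
    ... | inj₂ y≡ = prev i , sym y≡

    CycleEdge⇔ : ∀ {u v} → CycleEdge C u v ⇔ (u ∈ᶜ C × adj H u v ≡ true)
    CycleEdge⇔ = mk⇔ edge⇒ edge⇐
      where
      edge⇒ : ∀ {u v} → CycleEdge C u v → u ∈ᶜ C × adj H u v ≡ true
      edge⇒ (i , inj₁ (refl , refl)) = (i , refl) , vertAdj C i
      edge⇒ (i , inj₂ (refl , refl)) = (next i , refl) , trans (adjSym H _ _) (vertAdj C i)
      edge⇐ : ∀ {u v} → u ∈ᶜ C × adj H u v ≡ true → CycleEdge C u v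
      edge⇐ ((i , refl) , uv) with cycle-neighbours i uv
      ... | inj₁ v≡ = i , inj₁ (refl , sym v≡)
      ... | inj₂ v≡ = prev i , inj₂ (sym v≡ , cong (vert C) (next-prev i))

  shared-vertex⇒⊆ : ∀ {C D : Cycle H} {x} → x ∈ᶜ C → x ∈ᶜ D → ∀ {y} → y ∈ᶜ C → y ∈ᶜ D
  shared-vertex⇒⊆ {C} {D} (i₀ , refl) x∈D (i , refl) = next-invariant (λ i → vert C i ∈ᶜ D)
    (λ i p → ∈ᶜ-closed D p (vertAdj C i))
    (λ i p → ∈ᶜ-closed D p (trans (adjSym H _ _) (vertAdj C i)))
    x∈D i

  shared-vertex⇒SameCycle : ∀ {C D : Cycle H} {x} → x ∈ᶜ C → x ∈ᶜ D → SameCycle C D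
  shared-vertex⇒SameCycle {C} {D} x∈C x∈D u v =
    (λ e → let u∈C , uv = to (CycleEdge⇔ C) e in from (CycleEdge⇔ D) (shared-vertex⇒⊆ {C} {D} x∈C x∈D u∈C , uv)) ,
    (λ e → let u∈D , uv = to (CycleEdge⇔ D) e in from (CycleEdge⇔ C) (shared-vertex⇒⊆ {D} {C} x∈D x∈C u∈D , uv))

-- An internal partition leaves at most one odd cycle

smaller-side-independent : (H : Graph n) (S : Fin n → Bool) → CoInternalSide H S → count S ≤ count (not ∘ S) →
                           ∀ x → S x ≡ true → degIn H S x ≡ 0
smaller-side-independent H S side s≤t x Sx =
  2*h≤1⇒h≡0 (degIn H S x) (+-cancelʳ-≤ (count (not ∘ S)) _ 1 (≤-trans (side x Sx) (s≤s s≤t)))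
  where
  2*h≤1⇒h≡0 : ∀ h → 2 * h ≤ 1 → h ≡ 0
  2*h≤1⇒h≡0 zero    _        = refl
  2*h≤1⇒h≡0 (suc h) (s≤s le) with () ← subst (_≤ 0) (+-suc h (h + 0)) le

arcs-independent : (H : Graph n) (S : Fin n → Bool) → (∀ x → S x ≡ true → degIn H S x ≡ 0) → arcs H S S ≡ 0
arcs-independent H S independent = sum-zero λ x → summand x (S x) refl
  where
  summand : ∀ x b → S x ≡ b → ⟦ b ⟧ * degIn H S x ≡ 0
  summand x true  Sx = trans (*-identityˡ _) (independent x Sx)
  summand x false _  = refl

-- Each odd cycle has an edge inside A; three distinct ends of such edges would give arcs H A A ≥ 3.
few-inner-arcs⇒atMostOneOddCycle : (H : Graph n) → Regular H 2 → (A : Fin n → Bool) →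
  (∀ x → A x ≡ false → degIn H (not ∘ A) x ≡ 0) → arcs H A A ≤ 2 → AtMostOneOddCycle H
few-inner-arcs⇒atMostOneOddCycle H regular A B-independent arcs≤2 C D oddC oddD =
  TwoRegular.shared-vertex⇒SameCycle H regular {C} {D} u′∈C (j , refl)
  where
  monochromatic⇒arc : ∀ {u w} → adj H u w ≡ true → A u ≡ A w → 1 ≤ arcs-at H A A u
  monochromatic⇒arc {u} {w} uw same with A u in Au
  ... | true  = subst (1 ≤_) (sym (*-identityˡ _))
                  (count-point (λ v → A v ∧ adj H u v) (cong₂ _∧_ (sym same) uw))
  ... | false = contradiction (subst (1 ≤_) (B-independent u Au)
                  (count-point (λ v → not (A v) ∧ adj H u v) (cong₂ _∧_ (cong not (sym same)) uw))) λ ()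

  i-repeat : ∃ λ i → A (vert C i) ≡ A (vert C (next i))
  i-repeat = odd-colouring-repeats oddC (A ∘ vert C)
  j-repeat : ∃ λ j → A (vert D j) ≡ A (vert D (next j))
  j-repeat = odd-colouring-repeats oddD (A ∘ vert D)
  i : Fin (3 + m C)
  i = proj₁ i-repeat
  j : Fin (3 + m D)
  j = proj₁ j-repeat
  u w u′ : Fin _
  u = vert C i
  w = vert C (next i)
  u′ = vert D j

  1≤arcs-at-u : 1 ≤ arcs-at H A A u
  1≤arcs-at-u = monochromatic⇒arc (vertAdj C i) (proj₂ i-repeat)
  1≤arcs-at-w : 1 ≤ arcs-at H A A w
  1≤arcs-at-w = monochromatic⇒arc (trans (adjSym H _ _) (vertAdj C i)) (sym (proj₂ i-repeat))
  1≤arcs-at-u′ : 1 ≤ arcs-at H A A u′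
  1≤arcs-at-u′ = monochromatic⇒arc (vertAdj D j) (proj₂ j-repeat)

  u′∈C : u′ ∈ᶜ C
  u′∈C with u′ ≟ u | u′ ≟ w
  ... | yes u′≡u | _        = i , sym u′≡u
  ... | no _     | yes u′≡w = next i , sym u′≡w
  ... | no u′≢u  | no u′≢w  = contradiction (begin
    3                                                     ≤⟨ +-mono-≤ (+-mono-≤ 1≤arcs-at-u 1≤arcs-at-w) 1≤arcs-at-u′ ⟩
    arcs-at H A A u + arcs-at H A A w + arcs-at H A A u′  ≤⟨ sum-triple (arcs-at H A A) (adj⇒≢ H (vertAdj C i))
                                                                         (u′≢u ∘ sym) (u′≢w ∘ sym) ⟩
    arcs H A A                                            ≤⟨ arcs≤2 ⟩
    2                                                     ∎) (<-irrefl refl)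
    where open ≤-Reasoning

larger-side-sparse : (H : Graph n) → Regular H 2 → (A : Fin n → Bool) → IsCoInternalPartition H A →
  count (not ∘ A) ≤ count A → (∀ x → A x ≡ false → degIn H (not ∘ A) x ≡ 0) × arcs H A A ≤ 2
larger-side-sparse H regular A partition@(_ , _ , _ , sideB) b≤a = B-independent , arcs≤2
  where
  B-independent : ∀ x → A x ≡ false → degIn H (not ∘ A) x ≡ 0
  B-independent x Ax = smaller-side-independent H (not ∘ A) sideB
    (subst (count (not ∘ A) ≤_) (count-cong (sym ∘ Bool.not-involutive ∘ A)) b≤a) x (cong not Ax)

  arcs≤2 : arcs H A A ≤ 2
  arcs≤2 = +-cancelʳ-≤ (count (not ∘ A) * 2) _ 2 (begin
    arcs H A A + count (not ∘ A) * 2  ≡⟨ arcs-within-balance H regular A ⟩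
    arcs H (not ∘ A) (not ∘ A) + count A * 2
      ≡⟨ cong (_+ count A * 2) (arcs-independent H (not ∘ A) λ x Bx → B-independent x (Bool.not-injective Bx)) ⟩
    count A * 2                       ≤⟨ *-monoˡ-≤ 2 (proj₁ (coInternal⇒nearBisection H partition)) ⟩
    2 + count (not ∘ A) * 2           ∎)
    where open ≤-Reasoning

coInternal⇒atMostOneOddCycle : (H : Graph n) → Regular H 2 → (A : Fin n → Bool) →
                               IsCoInternalPartition H A → AtMostOneOddCycle H
coInternal⇒atMostOneOddCycle H regular A partition with ≤-total (count (not ∘ A)) (count A)
... | inj₁ b≤a = uncurry (few-inner-arcs⇒atMostOneOddCycle H regular A) (larger-side-sparse H regular A partition b≤a)
... | inj₂ a≤b = uncurry (few-inner-arcs⇒atMostOneOddCycle H regular (not ∘ A))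
  (larger-side-sparse H regular (not ∘ A) (coInternal-swap H partition)
    (subst (_≤ count (not ∘ A)) (count-cong (sym ∘ Bool.not-involutive ∘ A)) a≤b))

-- Every vertex of a 2-regular graph lies on a cycle

least : {P : ℕ → Set} → Decidable P → ∀ {k} → P k → ∃ λ j → P j × ∀ {i} → i < j → ¬ P i
least {P = P} P? = <-rec (λ k → P k → Least) minimise _
  where
  Least : Set
  Least = ∃ λ j → P j × ∀ {i} → i < j → ¬ P i
  minimise : ∀ k → (∀ {i} → i < k → P i → Least) → P k → Least
  minimise k below Pk with anyUpTo? P? k
  ... | yes (i , i<k , Pi) = below i<k Pi
  ... | no ¬below          = k , Pk , λ i<k Pi → ¬below (_ , i<k , Pi)

-- In a 2-regular graph, a walk that never immediately turns back closes up into a cycle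
-- at its first repeated vertex.
module NonBacktrackingWalk (H : Graph n) (regular : Regular H 2) (w : ℕ → Fin n)
                           (step : ∀ k → adj H (w k) (w (suc k)) ≡ true)
                           (no-return : ∀ k → w (suc (suc k)) ≢ w k) where

  open TwoRegular H regular

  Repeats : ℕ → Set
  Repeats j = ∃ λ i → i < j × w i ≡ w j

  first-repeat : ∃ λ J → Repeats J × ∀ {j} → j < J → ¬ Repeats j
  first-repeat with i , j , i<j , wi≡wj ← pigeonhole (n<1+n n) (w ∘ toℕ) =
    least (λ j → anyUpTo? (λ i → w i ≟ w j) j) (toℕ i , i<j , wi≡wj)

  -- The two neighbours of w (suc I) are w I and w (2 + I), so the walk can only re-enter
  -- a visited vertex other than w 0 through an earlier repetition.
  first-repeat-returns : ∀ {I J} → I < J → w I ≡ w J → (∀ {j} → j < J → ¬ Repeats j) → w 0 ≡ w J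
  first-repeat-returns {zero}  _ w0≡wJ _ = w0≡wJ
  first-repeat-returns {suc I} {suc J} (s<s I<J) wI≡wJ first
    with only-neighbours (no-return I ∘ sym) (trans (adjSym H _ _) (step I)) (step (suc I))
                         (subst (λ v → adj H v (w J) ≡ true) (sym wI≡wJ) (trans (adjSym H _ _) (step J)))
  ... | inj₁ wJ≡wI = contradiction (I , ≤-trans (n<1+n I) I<J , sym wJ≡wI) (first (n<1+n J))
  ... | inj₂ wJ≡w2+I with <-cmp (2 + I) J
  ...   | tri< 2+I<J _ _ = contradiction (2 + I , 2+I<J , sym wJ≡w2+I) (first (n<1+n J))
  ...   | tri≈ _ refl _  = contradiction (sym wI≡wJ) (no-return (suc I))
  ...   | tri> _ _ J<2+I with refl ← ≤-antisym I<J (s≤s⁻¹ J<2+I) =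
    contradiction wI≡wJ (adj⇒≢ H (step (suc I)))

  closed-walk-cycle : ∀ m → w (3 + m) ≡ w 0 → (∀ {i j} → i < j → j < 3 + m → w i ≢ w j) → Cycle H
  closed-walk-cycle m closes distinct = record
    { m = m ; vert = w ∘ toℕ ; vertInj = λ {i} {j} → injective i j ; vertAdj = adjacent }
    where
    injective : ∀ i j → w (toℕ i) ≡ w (toℕ j) → i ≡ j
    injective i j e with <-cmp (toℕ i) (toℕ j)
    ... | tri< i<j _ _ = contradiction e (distinct i<j (toℕ<n j))
    ... | tri≈ _ i≡j _ = toℕ-injective i≡j
    ... | tri> _ _ j<i = contradiction (sym e) (distinct j<i (toℕ<n i))

    adjacent : ∀ i → adj H (w (toℕ i)) (w (toℕ (next i))) ≡ true
    adjacent i with view i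
    ... | ‵fromℕ     = subst₂ (λ t v → adj H (w t) v ≡ true) (sym (toℕ-fromℕ (2 + m)))
                              (trans closes (cong (w ∘ toℕ) (sym next-fromℕ))) (step (2 + m))
    ... | ‵inject₁ j = subst₂ (λ s t → adj H (w s) (w t) ≡ true) (sym (toℕ-inject₁ j))
                              (cong toℕ (sym (next-inject₁ j))) (step (toℕ j))

  walk-cycle : Σ (Cycle H) (w 0 ∈ᶜ_)
  walk-cycle with J , (I , I<J , wI≡wJ) , first ← first-repeat =
    as-cycle J (first-repeat-returns I<J wI≡wJ first) I<J distinct
    where
    distinct : ∀ {i j} → i < j → j < J → w i ≢ w j
    distinct i<j j<J wi≡wj = first j<J (_ , i<j , wi≡wj)
    as-cycle : ∀ J → w 0 ≡ w J → I < J → (∀ {i j} → i < j → j < J → w i ≢ w j) → Σ (Cycle H) (w 0 ∈ᶜ_)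
    as-cycle 0 _       () _
    as-cycle 1 returns _ _ = contradiction returns (adj⇒≢ H (step 0))
    as-cycle 2 returns _ _ = contradiction (sym returns) (no-return 0)
    as-cycle (suc (suc (suc m))) returns _ distinct = closed-walk-cycle m (sym returns) distinct , zero , refl

module _ (H : Graph n) (regular : Regular H 2) where

  open TwoRegular H regular

  another-neighbour : ∀ p c → ∃ λ y → adj H c y ≡ true × y ≢ p
  another-neighbour p c with a , b , a≢b , ca , cb , _ ← neighbour-pair c | a ≟ p
  ... | yes refl = b , cb , a≢b ∘ sym
  ... | no a≢p   = a , ca , a≢p

  -- walk p c: the non-backtracking walk from c whose previous vertex was p
  walk : Fin n → Fin n → ℕ → Fin n
  walk p c zero    = c
  walk p c (suc k) = walk c (proj₁ (another-neighbour p c)) k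

  walk-step : ∀ p c k → adj H (walk p c k) (walk p c (suc k)) ≡ true
  walk-step p c zero    = proj₁ (proj₂ (another-neighbour p c))
  walk-step p c (suc k) = walk-step c _ k

  walk-no-return : ∀ p c k → walk p c (suc (suc k)) ≢ walk p c k
  walk-no-return p c zero    = proj₂ (proj₂ (another-neighbour c _))
  walk-no-return p c (suc k) = walk-no-return c _ k

  -- with x as its own predecessor, the first step may go to either neighbour
  opaque
    cycle-through : ∀ x → Σ (Cycle H) (x ∈ᶜ_)
    cycle-through x = NonBacktrackingWalk.walk-cycle H regular (walk x x) (walk-step x x) (walk-no-return x x)

-- Colouring along canonical cycles

module CanonicalCycles (H : Graph n) (regular : Regular H 2) where

  open TwoRegular H regular

  least-vertex : (C : Cycle H) → ∃ λ r → r ∈ᶜ C × ∀ {v} → v ∈ᶜ C → toℕ r ≤ toℕ v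
  least-vertex C with k , (r , refl , r∈C) , minimal ← least {P = λ k → ∃ λ v → toℕ v ≡ k × v ∈ᶜ C}
                                                   (λ k → any? λ v → (toℕ v ℕ.≟ k) ×-dec (v ∈ᶜ? C))
                                                   (vert C zero , refl , zero , refl) =
    r , r∈C , λ {v} v∈C → ≮⇒≥ λ v<r → minimal v<r (v , refl , v∈C)

  opaque
    representative : Cycle H → Fin n
    representative = proj₁ ∘ least-vertex

    representative∈ : ∀ C → representative C ∈ᶜ C
    representative∈ C = proj₁ (proj₂ (least-vertex C))

    representative-cong : ∀ {C D} → (∀ {v} → v ∈ᶜ C → v ∈ᶜ D) → (∀ {v} → v ∈ᶜ D → v ∈ᶜ C) →
                          representative C ≡ representative D
    representative-cong {C} {D} C⊆D D⊆C
      with r , r∈C , r-least ← least-vertex C | s , s∈D , s-least ← least-vertex D =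
      toℕ-injective (≤-antisym (r-least (D⊆C s∈D)) (s-least (C⊆D r∈C)))

  cycleAt : Fin n → Cycle H
  cycleAt = proj₁ ∘ cycle-through H regular

  rep : Fin n → Fin n
  rep = representative ∘ cycleAt

  rep-cong : ∀ {x y} → y ∈ᶜ cycleAt x → rep y ≡ rep x
  rep-cong {x} {y} y∈Cx = representative-cong
    (shared-vertex⇒⊆ {cycleAt y} {cycleAt x} y∈Cy y∈Cx)
    (shared-vertex⇒⊆ {cycleAt x} {cycleAt y} y∈Cx y∈Cy)
    where
    y∈Cy : y ∈ᶜ cycleAt y
    y∈Cy = proj₂ (cycle-through H regular y)

  rep∈cycleAt : ∀ x → rep x ∈ᶜ cycleAt x
  rep∈cycleAt x = representative∈ (cycleAt x)

  -- the cycle through x, chosen so that it is the same for all of its vertices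
  canonicalCycle : Fin n → Cycle H
  canonicalCycle = cycleAt ∘ rep

  ∈canonicalCycle : ∀ x → x ∈ᶜ canonicalCycle x
  ∈canonicalCycle x = shared-vertex⇒⊆ {cycleAt x} {canonicalCycle x}
    (rep∈cycleAt x) (proj₂ (cycle-through H regular (rep x))) (proj₂ (cycle-through H regular x))

  canonicalCycle-cong : ∀ {x y} → y ∈ᶜ canonicalCycle x → canonicalCycle y ≡ canonicalCycle x
  canonicalCycle-cong {x} y∈ = cong cycleAt (trans (rep-cong y∈) (rep-cong (rep∈cycleAt x)))

  opaque
    position : Cycle H → Fin n → ℕ
    position C y with y ∈ᶜ? C
    ... | yes (i , _) = toℕ i
    ... | no _        = 0

    position-vert : ∀ C i → position C (vert C i) ≡ toℕ i
    position-vert C i with vert C i ∈ᶜ? C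
    ... | yes (j , e) = cong toℕ (vertInj C e)
    ... | no ∉C       = contradiction (i , refl) ∉C

  colour : Fin n → Bool
  colour x = flips (position (canonicalCycle x) x) true

  colour-vert : ∀ x i → colour (vert (canonicalCycle x) i) ≡ flips (toℕ i) true
  colour-vert x i = cong (λ k → flips k true)
    (trans (cong (λ C → position C (vert (canonicalCycle x) i)) (canonicalCycle-cong (i , refl)))
           (position-vert (canonicalCycle x) i))

  module _ {x : Fin n} where
    private
      C : Cycle H
      C = canonicalCycle x
      i : Fin (3 + m C)
      i = proj₁ (∈canonicalCycle x)
      x≡ : vert C i ≡ x
      x≡ = proj₂ (∈canonicalCycle x)

      closing-at : ∀ j {k} → next j ≡ k → colour (vert C j) ≡ colour (vert C k) →
                   j ≡ fromℕ _ × k ≡ zero × colour (vert C j) ≡ true × OddCycle C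
      closing-at j refl same-jk
        with j≡last , true-at-j , odd ← flips-closing j (trans (sym (colour-vert x j)) (trans same-jk (colour-vert x (next j)))) =
        j≡last , trans (cong next j≡last) next-fromℕ , trans (colour-vert x j) true-at-j , odd

    monochromatic-edge : ∀ {y} → adj H x y ≡ true → colour x ≡ colour y →
                         colour x ≡ true × OddCycle (canonicalCycle x) × ClosingEdge (canonicalCycle x) x y
    monochromatic-edge {y} xy same = by-position (cycle-neighbours C i (subst (λ v → adj H v y ≡ true) (sym x≡) xy))
      where
      by-position : y ≡ vert C (next i) ⊎ y ≡ vert C (prev i) →
                    colour x ≡ true × OddCycle (canonicalCycle x) × ClosingEdge (canonicalCycle x) x y
      by-position (inj₁ y≡)
        with i≡last , j≡0 , true-at-i , odd ← closing-at i refl (trans (cong colour x≡) (trans same (cong colour y≡))) =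
        trans (cong colour (sym x≡)) true-at-i , odd ,
        inj₁ (trans (sym x≡) (cong (vert C) i≡last) , trans y≡ (cong (vert C) j≡0))
      by-position (inj₂ y≡)
        with p≡last , i≡0 , true-at-p , odd
               ← closing-at (prev i) (next-prev i) (trans (sym (cong colour y≡)) (trans (sym same) (cong colour (sym x≡)))) =
        trans (trans same (cong colour y≡)) true-at-p , odd ,
        inj₂ (trans (sym x≡) (cong (vert C) i≡0) , trans y≡ (cong (vert C) p≡last))

  monochromatic-edges-meet : AtMostOneOddCycle H →
    ∀ {x y x′ y′} → adj H x y ≡ true → colour x ≡ colour y → adj H x′ y′ ≡ true → colour x′ ≡ colour y′ →
    x′ ≡ x ⊎ x′ ≡ y
  monochromatic-edges-meet at-most-one {x} {y} {x′} {y′} xy same x′y′ same′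
    with _ , odd , closing ← monochromatic-edge xy same | _ , odd′ , closing′ ← monochromatic-edge x′y′ same′ =
    closing-edges-meet {C = canonicalCycle x} closing (subst (λ C → ClosingEdge C x′ y′) same-cycle closing′)
    where
    same-cycle : canonicalCycle x′ ≡ canonicalCycle x
    same-cycle = canonicalCycle-cong (SameCycle⇒⊆ {C = canonicalCycle x′} {D = canonicalCycle x}
      (at-most-one (canonicalCycle x′) (canonicalCycle x) odd′ odd) (∈canonicalCycle x′))

-- A colouring with a single inner edge is internal

⟦_⟧*-≤ : ∀ b m → ⟦ b ⟧ * m ≤ m
⟦ true  ⟧*-≤ m = ≤-reflexive (*-identityˡ m)
⟦ false ⟧*-≤ m = z≤n

m≤1⇒m≤n : ∀ {m n} → m ≤ 1 → (1 ≤ m → 1 ≤ n) → m ≤ n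
m≤1⇒m≤n {zero}        _        _   = z≤n
m≤1⇒m≤n {suc zero}    _        pos = pos (s≤s z≤n)
m≤1⇒m≤n {suc (suc _)} (s≤s ()) _

module SingleInnerEdge (H : Graph n) (regular : Regular H 2) (A : Fin n → Bool)
  (inner-in-A : ∀ {x y} → adj H x y ≡ true → A x ≡ A y → A x ≡ true)
  (inner-meet : ∀ {x y x′ y′} → adj H x y ≡ true → A x ≡ A y → adj H x′ y′ ≡ true → A x′ ≡ A y′ →
                x′ ≡ x ⊎ x′ ≡ y)
  where

  a b : ℕ
  a = count A
  b = count (not ∘ A)

  inner-edge : ∀ {x u} → A u ∧ adj H x u ≡ true → adj H x u ≡ true × A u ≡ true
  inner-edge {u = u} Au∧xu = ∧≡true⇒ʳ (A u) Au∧xu , ∧≡true⇒ˡ (A u) Au∧xu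

  B-independent : ∀ x → A x ≡ false → degIn H (not ∘ A) x ≡ 0
  B-independent x Ax = count-false no-outer-neighbour
    where
    no-outer-neighbour : ∀ u → not (A u) ∧ adj H x u ≡ false
    no-outer-neighbour u with A u in Au | adj H x u in xu
    ... | true  | _     = refl
    ... | false | false = refl
    ... | false | true  = contradiction (trans (sym Ax) (inner-in-A xu (trans Ax (sym Au)))) λ ()

  -- Two neighbours u, u′ of x inside A give inner edges xu′ and ux, so u ∈ {x , u′}.
  inner-degree≤1 : ∀ x → A x ≡ true → degIn H A x ≤ 1
  inner-degree≤1 x Ax = count≤1 (λ u → A u ∧ adj H x u) λ {u} {u′} u-inner u′-inner →
    let xu , Au = inner-edge u-inner ; xu′ , Au′ = inner-edge u′-inner in
    u≢x⇒≡ (inner-meet xu′ (trans Ax (sym Au′)) (trans (adjSym H u x) xu) (trans Au (sym Ax))) (adj⇒≢ H xu ∘ sym)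
    where
    u≢x⇒≡ : ∀ {u u′} → u ≡ x ⊎ u ≡ u′ → u ≢ x → u ≡ u′
    u≢x⇒≡ (inj₁ u≡x)  u≢x = contradiction u≡x u≢x
    u≢x⇒≡ (inj₂ u≡u′) _   = u≡u′

  arcs-at≤1 : ∀ x → arcs-at H A A x ≤ 1
  arcs-at≤1 x with A x in Ax
  ... | true  = ≤-trans (⟦ true ⟧*-≤ _) (inner-degree≤1 x Ax)
  ... | false = z≤n

  arcs-at-pos : ∀ {x} → 1 ≤ arcs-at H A A x → ∃ λ u → adj H x u ≡ true × A x ≡ A u
  arcs-at-pos {x} pos with A x in Ax
  ... | false with () ← pos
  ... | true with u , u-inner ← count-pos⇒∃ (λ u → A u ∧ adj H x u) (subst (1 ≤_) (*-identityˡ _) pos) =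
    u , proj₁ (inner-edge u-inner) , sym (proj₂ (inner-edge u-inner))

  arcs≤2 : arcs H A A ≤ 2
  arcs≤2 with any? (λ x → any? (λ y → (adj H x y Bool.≟ true) ×-dec (A x Bool.≟ A y)))
  ... | no no-inner-edge = begin
    arcs H A A               ≤⟨ sum-mono (λ x → m≤1⇒m≤n (arcs-at≤1 x) λ pos →
                                 let u , xu , same = arcs-at-pos pos in contradiction (x , u , xu , same) no-inner-edge) ⟩
    sum (λ (_ : Fin n) → 0)  ≡⟨ sum-zero {n} (λ _ → refl) ⟩
    0                        ≤⟨ z≤n ⟩
    2                        ∎
    where open ≤-Reasoning
  ... | yes (x₀ , y₀ , x₀y₀ , same₀) = begin
    arcs H A A
      ≤⟨ sum-mono (λ x → m≤1⇒m≤n (arcs-at≤1 x) λ pos →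
           let u , xu , same = arcs-at-pos pos in end (inner-meet x₀y₀ same₀ xu same)) ⟩
    sum (λ x → ⟦ ⌊ x₀ ≟ x ⌋ ⟧ + ⟦ ⌊ y₀ ≟ x ⌋ ⟧)
      ≡⟨ ∑-distrib-+ (λ x → ⟦ ⌊ x₀ ≟ x ⌋ ⟧) (λ x → ⟦ ⌊ y₀ ≟ x ⌋ ⟧) ⟩
    sum (λ x → ⟦ ⌊ x₀ ≟ x ⌋ ⟧) + sum (λ x → ⟦ ⌊ y₀ ≟ x ⌋ ⟧)
      ≡⟨ cong₂ _+_ (trans (sym (count≡sum (λ x → ⌊ x₀ ≟ x ⌋))) (count-singleton x₀))
                   (trans (sym (count≡sum (λ x → ⌊ y₀ ≟ x ⌋))) (count-singleton y₀)) ⟩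
    2                                              ∎
    where
    open ≤-Reasoning
    end : ∀ {x} → x ≡ x₀ ⊎ x ≡ y₀ → 1 ≤ ⟦ ⌊ x₀ ≟ x ⌋ ⟧ + ⟦ ⌊ y₀ ≟ x ⌋ ⟧
    end (inj₁ refl) = subst (λ e → 1 ≤ ⟦ e ⟧ + ⟦ ⌊ y₀ ≟ x₀ ⌋ ⟧) (sym (⌊≟⌋-refl {x = x₀})) (s≤s z≤n)
    end (inj₂ refl) = subst (λ e → 1 ≤ ⟦ ⌊ x₀ ≟ y₀ ⌋ ⟧ + ⟦ e ⟧) (sym (⌊≟⌋-refl {x = y₀})) (m≤n+m 1 _)

  balance : arcs H A A + b * 2 ≡ a * 2
  balance = trans (arcs-within-balance H regular A)
    (cong (_+ a * 2) (arcs-independent H (not ∘ A) λ x Bx → B-independent x (Bool.not-injective Bx)))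

  b≤a : b ≤ a
  b≤a = *-cancelʳ-≤ b a 2 (subst (b * 2 ≤_) balance (m≤n+m _ _))

  b<a : 1 ≤ arcs H A A → b < a
  b<a pos = *-cancelʳ-< 2 b a (subst (b * 2 <_) balance (+-monoˡ-≤ (b * 2) pos))

  a≤1+b : a ≤ suc b
  a≤1+b = *-cancelʳ-≤ a (suc b) 2 (subst (_≤ suc b * 2) balance (+-monoˡ-≤ (b * 2) arcs≤2))

  degIn≤arcs : ∀ x → A x ≡ true → degIn H A x ≤ arcs H A A
  degIn≤arcs x Ax = subst (_≤ arcs H A A) (trans (cong (λ c → ⟦ c ⟧ * degIn H A x) Ax) (*-identityˡ _))
                      (sum-point (arcs-at H A A) x)

  A-side : CoInternalSide H A
  A-side x Ax with degIn H A x | inner-degree≤1 x Ax | degIn≤arcs x Ax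
  ... | zero        | _      | _      = m≤n⇒m≤1+n b≤a
  ... | suc zero    | _      | 1≤arcs = s≤s (b<a 1≤arcs)
  ... | suc (suc _) | s≤s () | _

  B-side : CoInternalSide H (not ∘ A)
  B-side x Bx = begin
    2 * degIn H (not ∘ A) x + count (not ∘ (not ∘ A))
      ≡⟨ cong₂ (λ d c → 2 * d + c) (B-independent x (Bool.not-injective Bx)) (count-cong (Bool.not-involutive ∘ A)) ⟩
    a                                                  ≤⟨ a≤1+b ⟩
    suc b                                              ∎
    where open ≤-Reasoning

  1≤b : 2 ≤ n → 1 ≤ b
  1≤b 2≤n with b in b≡ | a≤1+b
  ... | suc _ | _   = s≤s z≤n
  ... | zero  | a≤1 = contradiction (begin
    2      ≤⟨ 2≤n ⟩
    n      ≡⟨ count+count-not A ⟨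
    a + b  ≡⟨ cong (a +_) b≡ ⟩
    a + 0  ≡⟨ +-identityʳ a ⟩
    a      ≤⟨ a≤1 ⟩
    1      ∎) (<-irrefl refl)
    where open ≤-Reasoning

  single-inner-edge⇒coInternal : 2 ≤ n → IsCoInternalPartition H A
  single-inner-edge⇒coInternal 2≤n = count-pos⇒∃ A (≤-trans (1≤b 2≤n) b≤a) , B-nonempty , A-side , B-side
    where
    B-nonempty : ∃ λ x → A x ≡ false
    B-nonempty = let x , Bx = count-pos⇒∃ (not ∘ A) (1≤b 2≤n) in x , Bool.not-injective Bx

theorem3 : (n : ℕ) → 3 ≤ n → (G : Graph n) → Regular G (n ∸ 3) →
             ((HasInternalPartition G → AtMostOneOddCycle (complement G))
             × (AtMostOneOddCycle (complement G) → HasInternalPartition G))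
             × (HasInternalPartition G →
                 ∃ λ A → IsInternalPartition G A × NearBisection A)
theorem3 n 3≤n G regular = (internal⇒atMostOneOddCycle , atMostOneOddCycle⇒internal) , internal⇒nearBisection
  where
  H : Graph n
  H = complement G
  H-regular : Regular H 2
  H-regular = complement-regular 3≤n G regular
  internal⇔ : ∀ A → IsInternalPartition G A ⇔ IsCoInternalPartition H A
  internal⇔ = internal⇔coInternal 3≤n G regular

  internal⇒atMostOneOddCycle : HasInternalPartition G → AtMostOneOddCycle H
  internal⇒atMostOneOddCycle (A , internal) = coInternal⇒atMostOneOddCycle H H-regular A (to (internal⇔ A) internal)

  atMostOneOddCycle⇒internal : AtMostOneOddCycle H → HasInternalPartition G
  atMostOneOddCycle⇒internal at-most-one = colour , from (internal⇔ colour)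
    (SingleInnerEdge.single-inner-edge⇒coInternal H H-regular colour
      (λ xy same → proj₁ (monochromatic-edge xy same)) (monochromatic-edges-meet at-most-one) (≤-trans (n≤1+n 2) 3≤n))
    where open CanonicalCycles H H-regular

  internal⇒nearBisection : HasInternalPartition G → ∃ λ A → IsInternalPartition G A × NearBisection A
  internal⇒nearBisection (A , internal) = A , internal , coInternal⇒nearBisection H (to (internal⇔ A) internal)
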